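{- Let $N\ge 1$ and let $Q$ be a set of queens placed on distinct squares of the $N\times N$ chessboard such that (i) every square of the board either contains a queen of $Q$ or lies in the same row, column or diagonal as some queen of $Q$, and (ii) the graph $G(Q)$ is connected. Then $|Q|\ge \left\lceil 2N/3-1\right\rceil$.
   Context: Squares are $(x,y)$ with $1\le x,y\le N$. A queen on $(x,y)$ covers every square in column $x$, in row $y$, and on the two diagonals through $(x,y)$; other queens do not block this coverage. A "line" means a row, a column, or a diagonal (in either direction). $G(Q)$ is the graph whose vertices are the queens of $Q$, with an edge between two queens exactly when they lie on a common line and no other queen of $Q$ lies on that line strictly between them. Thus $p$ queens on one line contribute a path with $p-1$ edges. -}

module Defs where

open import Data.Nat using (ℕ; _+_; _*_; _∸_; _≤_; _<_)
open import Data.Nat.DivMod using (_/_)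
open import Data.Product using (_×_; _,_; ∃-syntax)
open import Data.Sum using (_⊎_)
open import Data.List using (List)
open import Data.List.Membership.Propositional using (_∈_)
open import Relation.Binary.PropositionalEquality using (_≡_)
open import Relation.Nullary using (¬_)
open import Relation.Binary.Construct.Closure.ReflexiveTransitive using (Star)

Square : Set
Square = ℕ × ℕ

col row : Square → ℕ
col (x , _) = x
row (_ , y) = y

OnBoard : ℕ → Square → Set
OnBoard N (x , y) = (1 ≤ x × x ≤ N) × (1 ≤ y × y ≤ N)

StrictlyBetween : ℕ → ℕ → ℕ → Set
StrictlyBetween a b c = (a < b × b < c) ⊎ (c < b × b < a)

SameCol SameRow SameDiag SameAnti : Square → Square → Set
SameCol  (x , y) (x' , y') = x ≡ x'
SameRow  (x , y) (x' , y') = y ≡ y'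
SameDiag (x , y) (x' , y') = x + y' ≡ x' + y     -- x - y = x' - y'
SameAnti (x , y) (x' , y') = x + y ≡ x' + y'

SameLine : Square → Square → Set
SameLine p q = SameCol p q ⊎ SameRow p q ⊎ SameDiag p q ⊎ SameAnti p q

Covers : Square → Square → Set
Covers s t = s ≡ t ⊎ SameLine s t

Dominating : ℕ → List Square → Set
Dominating N Q = ∀ t → OnBoard N t → ∃[ q ] (q ∈ Q × Covers q t)

BetweenCol BetweenRow BetweenDiag BetweenAnti : Square → Square → Square → Set
BetweenCol  p r q = SameCol p r  × SameCol r q  × StrictlyBetween (row p) (row r) (row q)
BetweenRow  p r q = SameRow p r  × SameRow r q  × StrictlyBetween (col p) (col r) (col q)
BetweenDiag p r q = SameDiag p r × SameDiag r q × StrictlyBetween (col p) (col r) (col q)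
BetweenAnti p r q = SameAnti p r × SameAnti r q × StrictlyBetween (col p) (col r) (col q)

NoQueenBetween : List Square → (Square → Square → Square → Set) → Square → Square → Set
NoQueenBetween Q B p q = ∀ r → r ∈ Q → ¬ B p r q

-- Edge of G(Q): two distinct queens on a common line with no queen of Q
-- strictly between them on that line.
Adj : List Square → Square → Square → Set
Adj Q p q = p ∈ Q × q ∈ Q × ¬ (p ≡ q) ×
  ( (SameCol  p q × NoQueenBetween Q BetweenCol  p q)
  ⊎ (SameRow  p q × NoQueenBetween Q BetweenRow  p q)
  ⊎ (SameDiag p q × NoQueenBetween Q BetweenDiag p q)
  ⊎ (SameAnti p q × NoQueenBetween Q BetweenAnti p q))

Connected : List Square → Set
Connected Q = ∀ p q → p ∈ Q → q ∈ Q → Star (Adj Q) p q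

-- ⌈2N/3 - 1⌉ = ⌈2N/3⌉ - 1 (valid for N ≥ 1, where this is ≥ 0),
-- with ⌈2N/3⌉ = ⌊(2N+2)/3⌋.
ceil2N/3-1 : ℕ → ℕ
ceil2N/3-1 N = ((2 * N + 2) / 3) ∸ 1

-- Let L be the number of occupied lines: rows, columns, diagonals and antidiagonals
-- containing a queen.  Adding the queens of a connected G(Q) one neighbour at a time,
-- each new queen shares a line with an earlier one, so L ≤ 4 + 3(|Q| - 1).
--
-- For the lower bound let a < b be the outermost empty columns and c ≤ d the outermost
-- empty rows.  A square in an empty row and an empty column is covered along a diagonal
-- or an antidiagonal only.  So every empty row meets an occupied (anti)diagonal on
-- column a and again on column b, and every empty column strictly between a and b does
-- so on row c and on row d.  Along the left and top sides of the rectangle [a,b]×[c,d]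
-- the antidiagonals are pairwise distinct, and so are those along its bottom and right
-- sides; symmetrically for diagonals.  Hence (empty rows) + (empty columns) - 2 is at
-- most the number of occupied diagonals and antidiagonals, i.e. 2N ≤ L + 2 ≤ 3|Q| + 3.
-- With fewer than two empty columns or no empty row, N ≤ |Q| + 1 already suffices.

module Submission where

open import Defs

open import Data.Nat
open import Data.Nat.Properties
open import Data.Nat.DivMod using (m<n*o⇒m/o<n)
open import Data.Nat.Tactic.RingSolver using (solve-∀)
open import Data.Product using (_×_; _,_; ∃₂)
open import Data.Product.Properties using (≡-dec)
open import Data.Sum using (_⊎_; inj₁; inj₂)
open import Data.Empty using (⊥-elim)
open import Function using (_∘_)
open import Data.List using (List; []; _∷_; [_]; length)
open import Data.List.Properties using (length-removeAt′)
open import Data.List.Membership.Propositional using (_∈_; _∉_)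
open import Data.List.Relation.Binary.Subset.Propositional using (_⊆_)
open import Data.List.Relation.Unary.All using (All)
open import Data.List.Relation.Unary.Unique.Propositional using (Unique)
open import Data.List.Relation.Unary.Any using (here; there; index; _─_)
open import Relation.Binary.PropositionalEquality hiding ([_])
open import Relation.Nullary using (¬_; Dec; yes; no)
open import Relation.Binary.Construct.Closure.ReflexiveTransitive using (Star; ε; _◅_)
open import Data.List.Membership.DecPropositional (≡-dec _≟_ _≟_) using (_∈?_)

m≤n+1⇒m+m≤3n+3 : ∀ {m n} → m ≤ n + 1 → m + m ≤ 3 * n + 3
m≤n+1⇒m+m≤3n+3 {m} {n} m≤n+1 = ≤-trans (+-mono-≤ m≤n+1 m≤n+1) (≤-trans (m≤m+n _ (n + 1)) (≤-reflexive (triple n)))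
  where
  triple : ∀ n → n + 1 + (n + 1) + (n + 1) ≡ 3 * n + 3
  triple = solve-∀

-- Finite sums

∑ : (ℕ → ℕ) → ℕ → ℕ
∑ g zero    = 0
∑ g (suc n) = ∑ g n + g n

_from_ : (ℕ → ℕ) → ℕ → ℕ → ℕ
(g from a) i = g (a + i)

∑-cong : ∀ {g h} n → (∀ i → i < n → g i ≡ h i) → ∑ g n ≡ ∑ h n
∑-cong zero    _   = refl
∑-cong (suc n) g≡h = cong₂ _+_ (∑-cong n (λ i i<n → g≡h i (m<n⇒m<1+n i<n))) (g≡h n ≤-refl)

∑-mono-≤ : ∀ {g h} n → (∀ i → i < n → g i ≤ h i) → ∑ g n ≤ ∑ h n
∑-mono-≤ zero    _   = z≤n
∑-mono-≤ (suc n) g≤h = +-mono-≤ (∑-mono-≤ n (λ i i<n → g≤h i (m<n⇒m<1+n i<n))) (g≤h n ≤-refl)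

∑-distrib-+ : ∀ g h n → ∑ (λ i → g i + h i) n ≡ ∑ g n + ∑ h n
∑-distrib-+ g h zero    = refl
∑-distrib-+ g h (suc n) = begin
  ∑ (λ i → g i + h i) n + (g n + h n) ≡⟨ cong (_+ (g n + h n)) (∑-distrib-+ g h n) ⟩
  ∑ g n + ∑ h n + (g n + h n)         ≡⟨ +-+-interchange (∑ g n) (∑ h n) (g n) (h n) ⟩
  ∑ g n + g n + (∑ h n + h n)         ∎
  where
  open ≡-Reasoning
  +-+-interchange : ∀ a b c d → a + b + (c + d) ≡ a + c + (b + d)
  +-+-interchange = solve-∀

∑-++ : ∀ g m n → ∑ g (m + n) ≡ ∑ g m + ∑ (g from m) n
∑-++ g m zero    = trans (cong (∑ g) (+-identityʳ m)) (sym (+-identityʳ (∑ g m)))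
∑-++ g m (suc n) rewrite +-suc m n | ∑-++ g m n = +-assoc (∑ g m) (∑ (g from m) n) (g (m + n))

∑-reverse : ∀ g n → ∑ (λ i → g (n ∸ suc i)) n ≡ ∑ g n
∑-reverse g zero    = refl
∑-reverse g (suc n) = begin
  ∑ (λ i → g (suc n ∸ suc i)) (suc n) ≡⟨ ∑-++ (λ i → g (suc n ∸ suc i)) 1 n ⟩
  g n + ∑ (λ i → g (n ∸ suc i)) n     ≡⟨ cong (g n +_) (∑-reverse g n) ⟩
  g n + ∑ g n                         ≡⟨ +-comm (g n) (∑ g n) ⟩
  ∑ g n + g n                         ∎
  where open ≡-Reasoning

∑-const : ∀ c n → ∑ (λ _ → c) n ≡ n * c
∑-const c zero    = refl
∑-const c (suc n) = trans (cong (_+ c) (∑-const c n)) (+-comm (n * c) c)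

∑-window-≤ : ∀ g a n {M} → a + n ≤ M → ∑ (g from a) n ≤ ∑ g M
∑-window-≤ g a n {M} a+n≤M with k , refl ← m≤n⇒∃[o]m+o≡n a+n≤M = begin
  ∑ (g from a) n                ≤⟨ m≤n+m _ _ ⟩
  ∑ g a + ∑ (g from a) n        ≡⟨ ∑-++ g a n ⟨
  ∑ g (a + n)                   ≤⟨ m≤m+n _ _ ⟩
  ∑ g (a + n) + ∑ (g from (a + n)) k ≡⟨ ∑-++ g (a + n) k ⟨
  ∑ g (a + n + k)               ∎
  where open ≤-Reasoning

∑-adjacent-windows-≤ : ∀ g a m n {M} → a + m + n ≤ M →
  ∑ (g from a) m + ∑ (g from (a + m)) n ≤ ∑ g M
∑-adjacent-windows-≤ g a m n {M} a+m+n≤M = begin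
  ∑ (g from a) m + ∑ (g from (a + m)) n   ≡⟨ cong (∑ (g from a) m +_) (∑-cong n λ i _ → cong g (+-assoc a m i)) ⟩
  ∑ (g from a) m + ∑ ((g from a) from m) n ≡⟨ ∑-++ (g from a) m n ⟨
  ∑ (g from a) (m + n)                     ≤⟨ ∑-window-≤ g a (m + n) (subst (_≤ M) (+-assoc a m n) a+m+n≤M) ⟩
  ∑ g M                                    ∎
  where open ≤-Reasoning

∑-≤-interior+2 : ∀ g p → (∀ i → g i ≤ 1) → ∑ g (2 + p) ≤ ∑ (g from 1) p + 2
∑-≤-interior+2 g p g≤1 = begin
  ∑ g (suc p) + g (suc p)          ≡⟨ cong (_+ g (suc p)) (∑-++ g 1 p) ⟩
  g 0 + ∑ (g from 1) p + g (suc p) ≤⟨ +-mono-≤ (+-monoˡ-≤ _ (g≤1 0)) (g≤1 (suc p)) ⟩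
  1 + ∑ (g from 1) p + 1           ≡⟨ cong (_+ 1) (+-comm 1 _) ⟩
  ∑ (g from 1) p + 1 + 1           ≡⟨ +-assoc _ 1 1 ⟩
  ∑ (g from 1) p + 2               ∎
  where open ≤-Reasoning

∑-first-nonzero : ∀ g n → ∑ g n ≡ 0 ⊎ ∃₂ λ j m → n ≡ j + suc m × ∑ g j ≡ 0 × 0 < g j
∑-first-nonzero g zero = inj₁ refl
∑-first-nonzero g (suc n) with ∑-first-nonzero g n
... | inj₂ (j , m , refl , ∑≡0 , 0<gj) = inj₂ (j , suc m , sym (+-suc j (suc m)) , ∑≡0 , 0<gj)
... | inj₁ ∑≡0 with g n in gn≡
...   | zero  = inj₁ (cong₂ _+_ ∑≡0 refl)
...   | suc _ = inj₂ (n , 0 , +-comm 1 n , ∑≡0 , subst (0 <_) (sym gn≡) z<s)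

∑-last-nonzero : ∀ g n → ∑ g n ≡ 0 ⊎ ∃₂ λ j m → n ≡ j + suc m × 0 < g j × ∑ (g from suc j) m ≡ 0
∑-last-nonzero g zero = inj₁ refl
∑-last-nonzero g (suc n) with g n in gn≡
... | suc _ = inj₂ (n , 0 , +-comm 1 n , subst (0 <_) (sym gn≡) z<s , refl)
... | zero with ∑-last-nonzero g n
...   | inj₁ ∑≡0 = inj₁ (cong (_+ 0) ∑≡0)
...   | inj₂ (j , m , refl , 0<gj , ∑≡0) =
  inj₂ (j , suc m , sym (+-suc j (suc m)) , 0<gj , cong₂ _+_ ∑≡0 (trans (cong g (sym (+-suc j m))) gn≡))

∑-support : ∀ g n → ∑ g n ≡ 0 ⊎
  ∃₂ λ j l → j + suc l ≤ n × 0 < g j × 0 < g (j + l) × ∑ g n ≡ ∑ (g from j) (suc l)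
∑-support g n with ∑-first-nonzero g n
... | inj₁ ∑≡0 = inj₁ ∑≡0
... | inj₂ (j , m , refl , ∑<j≡0 , 0<gj) with ∑-last-nonzero (g from j) (suc m)
...   | inj₁ ∑≡0 = ⊥-elim (<⇒≢ 0<gj0 (sym (m+n≡0⇒m≡0 _ (trans (sym (∑-++ (g from j) 1 m)) ∑≡0))))
  where
  0<gj0 : 0 < g (j + 0)
  0<gj0 = subst (λ i → 0 < g i) (sym (+-identityʳ j)) 0<gj
...   | inj₂ (l , k , suc-m≡ , 0<gjl , ∑>l≡0) = inj₂ (j , l , j+suc-l≤ , 0<gj , 0<gjl , ∑≡window)
  where
  j+suc-l≤ : j + suc l ≤ j + suc m
  j+suc-l≤ = +-monoʳ-≤ j (subst (suc l ≤_) (trans (sym (+-suc l k)) (sym suc-m≡)) (s≤s (m≤m+n l k)))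
  ∑≡window : ∑ g (j + suc m) ≡ ∑ (g from j) (suc l)
  ∑≡window = begin
    ∑ g (j + suc m)                                 ≡⟨ ∑-++ g j (suc m) ⟩
    ∑ g j + ∑ (g from j) (suc m)                    ≡⟨ cong₂ _+_ ∑<j≡0 (cong (∑ (g from j)) suc-m≡) ⟩
    ∑ (g from j) (l + suc k)                        ≡⟨ cong (∑ (g from j)) (+-suc l k) ⟩
    ∑ (g from j) (suc l + k)                        ≡⟨ ∑-++ (g from j) (suc l) k ⟩
    ∑ (g from j) (suc l) + ∑ ((g from j) from suc l) k ≡⟨ cong (∑ (g from j) (suc l) +_) ∑>l≡0 ⟩
    ∑ (g from j) (suc l) + 0                        ≡⟨ +-identityʳ _ ⟩
    ∑ (g from j) (suc l)                            ∎
    where open ≡-Reasoning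

-- Occupied values

module _ {A : Set} (f : A → ℕ) where

  occupied : List A → ℕ → ℕ
  occupied []      v = 0
  occupied (q ∷ P) v with f q ≟ v
  ... | yes _ = 1
  ... | no  _ = occupied P v

  occupied-∈ : ∀ {q P} → q ∈ P → occupied P (f q) ≡ 1
  occupied-∈ {q} {p ∷ P} q∈ with f p ≟ f q | q∈
  ... | yes _   | _         = refl
  ... | no  _   | there q∈P = occupied-∈ q∈P
  ... | no fp≢ | here refl = ⊥-elim (fp≢ refl)

  occupied-mono : ∀ {P P′} v → P ⊆ P′ → occupied P v ≤ occupied P′ v
  occupied-mono {[]}    v _    = z≤n
  occupied-mono {q ∷ P} v P⊆P′ with f q ≟ v
  ... | yes refl = ≤-reflexive (sym (occupied-∈ (P⊆P′ (here refl))))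
  ... | no  _    = occupied-mono v (P⊆P′ ∘ there)

  occupied-∷-≤ : ∀ z P v → occupied (z ∷ P) v ≤ occupied P v + occupied [ z ] v
  occupied-∷-≤ z P v with f z ≟ v
  ... | yes _ = m≤n+m 1 _
  ... | no  _ = m≤m+n _ _

  occupied-∷-shared : ∀ {w} z P v → w ∈ P → f w ≡ f z → occupied (z ∷ P) v ≤ occupied P v
  occupied-∷-shared z P v w∈P fw≡fz with f z ≟ v
  ... | yes refl = ≤-reflexive (sym (subst (λ u → occupied P u ≡ 1) fw≡fz (occupied-∈ w∈P)))
  ... | no  _    = ≤-refl

  ∑-occupied-singleton-below : ∀ z n → n ≤ f z → ∑ (occupied [ z ]) n ≡ 0
  ∑-occupied-singleton-below z zero    _ = refl
  ∑-occupied-singleton-below z (suc n) n<fz with f z ≟ n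
  ... | yes fz≡n = ⊥-elim (<-irrefl (sym fz≡n) n<fz)
  ... | no  _    = cong (_+ 0) (∑-occupied-singleton-below z n (<⇒≤ n<fz))

  ∑-occupied-singleton-≤-1 : ∀ z n → ∑ (occupied [ z ]) n ≤ 1
  ∑-occupied-singleton-≤-1 z zero    = z≤n
  ∑-occupied-singleton-≤-1 z (suc n) with f z ≟ n
  ... | yes refl = ≤-reflexive (cong (_+ 1) (∑-occupied-singleton-below z n ≤-refl))
  ... | no  _    = ≤-trans (≤-reflexive (+-identityʳ _)) (∑-occupied-singleton-≤-1 z n)

  distinct : ℕ → List A → ℕ
  distinct M P = ∑ (occupied P) M

  distinct-∷-≤ : ∀ M z P → distinct M (z ∷ P) ≤ distinct M P + 1
  distinct-∷-≤ M z P = begin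
    ∑ (occupied (z ∷ P)) M                          ≤⟨ ∑-mono-≤ M (λ v _ → occupied-∷-≤ z P v) ⟩
    ∑ (λ v → occupied P v + occupied [ z ] v) M     ≡⟨ ∑-distrib-+ (occupied P) (occupied [ z ]) M ⟩
    distinct M P + ∑ (occupied [ z ]) M             ≤⟨ +-monoʳ-≤ (distinct M P) (∑-occupied-singleton-≤-1 z M) ⟩
    distinct M P + 1                                ∎
    where open ≤-Reasoning

  distinct-∷-shared : ∀ {w} M z P → w ∈ P → f w ≡ f z → distinct M (z ∷ P) ≤ distinct M P
  distinct-∷-shared M z P w∈P fw≡fz = ∑-mono-≤ M (λ v _ → occupied-∷-shared z P v w∈P fw≡fz)

  distinct-mono : ∀ M {P P′} → P ⊆ P′ → distinct M P ≤ distinct M P′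
  distinct-mono M P⊆P′ = ∑-mono-≤ M (λ v _ → occupied-mono v P⊆P′)

  distinct-≤-length : ∀ M P → distinct M P ≤ length P
  distinct-≤-length M []      = ≤-reflexive (trans (∑-const 0 M) (*-zeroʳ M))
  distinct-≤-length M (z ∷ P) =
    ≤-trans (distinct-∷-≤ M z P) (≤-trans (+-monoˡ-≤ 1 (distinct-≤-length M P)) (≤-reflexive (+-comm (length P) 1)))

Star-exit : ∀ {A : Set} {R : A → A → Set} {P : A → Set} → (∀ x → Dec (P x)) →
  ∀ {u v} → Star R u v → P u → ¬ P v → ∃₂ λ w z → P w × ¬ P z × R w z
Star-exit P? ε                  Pu ¬Pv = ⊥-elim (¬Pv Pu)
Star-exit P? (_◅_ {j = m} uRm m⋆v) Pu ¬Pv with P? m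
... | yes Pm = Star-exit P? m⋆v Pm ¬Pv
... | no ¬Pm = _ , _ , Pu , ¬Pm , uRm

module _ {A : Set} where

  _⊆_∪_ : List A → List A → List A → Set
  Q ⊆ P ∪ R = ∀ {q} → q ∈ Q → q ∈ P ⊎ q ∈ R

  ∈-─ : ∀ {x y : A} (xs : List A) (x∈xs : x ∈ xs) → y ∈ xs → y ≡ x ⊎ y ∈ (xs ─ x∈xs)
  ∈-─ (_ ∷ _)  (here refl) (here refl) = inj₁ refl
  ∈-─ (_ ∷ _)  (here _)    (there y∈) = inj₂ y∈
  ∈-─ (_ ∷ _)  (there _)   (here refl) = inj₂ (here refl)
  ∈-─ (_ ∷ xs) (there x∈)  (there y∈) with ∈-─ xs x∈ y∈
  ... | inj₁ y≡x = inj₁ y≡x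
  ... | inj₂ y∈─ = inj₂ (there y∈─)

  ─-⊆ : ∀ {x : A} (xs : List A) (x∈xs : x ∈ xs) → (xs ─ x∈xs) ⊆ xs
  ─-⊆ (_ ∷ _)  (here _)  y∈         = there y∈
  ─-⊆ (_ ∷ _)  (there _) (here refl) = here refl
  ─-⊆ (_ ∷ xs) (there x∈) (there y∈) = there (─-⊆ xs x∈ y∈)

Adj⇒SameLine : ∀ {Q p q} → Adj Q p q → SameLine p q
Adj⇒SameLine (_ , _ , _ , inj₁ (same , _))               = inj₁ same
Adj⇒SameLine (_ , _ , _ , inj₂ (inj₁ (same , _)))        = inj₂ (inj₁ same)
Adj⇒SameLine (_ , _ , _ , inj₂ (inj₂ (inj₁ (same , _)))) = inj₂ (inj₂ (inj₁ same))
Adj⇒SameLine (_ , _ , _ , inj₂ (inj₂ (inj₂ (same , _)))) = inj₂ (inj₂ (inj₂ same))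

module Board (N : ℕ) where

  M : ℕ
  M = suc (N + N)

  -- x - y shifted by N; truncation can only merge diagonals off the board, and
  -- diagonal-≡ below holds for all squares.
  antidiagonal diagonal : Square → ℕ
  antidiagonal (x , y) = x + y
  diagonal     (x , y) = x + N ∸ y

  -- Every line index of a square on the board is below M.
  lines : List Square → ℕ
  lines P = distinct col M P + distinct row M P + distinct antidiagonal M P + distinct diagonal M P

  diagonal-≡ : ∀ p q → SameDiag p q → diagonal p ≡ diagonal q
  diagonal-≡ (x , y) (x′ , y′) x+y′≡x′+y = begin
    x + N ∸ y                   ≡⟨ [m+n]∸[m+o]≡n∸o y′ (x + N) y ⟨
    y′ + (x + N) ∸ (y′ + y)     ≡⟨ cong₂ _∸_ shift (+-comm y′ y) ⟩
    y + (x′ + N) ∸ (y + y′)     ≡⟨ [m+n]∸[m+o]≡n∸o y (x′ + N) y′ ⟩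
    x′ + N ∸ y′                 ∎
    where
    open ≡-Reasoning
    reassoc : ∀ a b n → b + (a + n) ≡ a + b + n
    reassoc = solve-∀
    shift : y′ + (x + N) ≡ y + (x′ + N)
    shift = trans (reassoc x y′ N) (trans (cong (_+ N) x+y′≡x′+y) (sym (reassoc x′ y N)))

  private
    lines-∷-≤-offsets : ∀ z P i₁ i₂ i₃ i₄ →
      distinct col M (z ∷ P) ≤ distinct col M P + i₁ →
      distinct row M (z ∷ P) ≤ distinct row M P + i₂ →
      distinct antidiagonal M (z ∷ P) ≤ distinct antidiagonal M P + i₃ →
      distinct diagonal M (z ∷ P) ≤ distinct diagonal M P + i₄ →
      lines (z ∷ P) ≤ lines P + (i₁ + i₂ + i₃ + i₄)
    lines-∷-≤-offsets z P i₁ i₂ i₃ i₄ c r a d =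
      ≤-trans (+-mono-≤ (+-mono-≤ (+-mono-≤ c r) a) d)
        (≤-reflexive (interchange (distinct col M P) (distinct row M P) (distinct antidiagonal M P)
                                  (distinct diagonal M P) i₁ i₂ i₃ i₄))
      where
      interchange : ∀ a b c d i j k l → a + i + (b + j) + (c + k) + (d + l) ≡ a + b + c + d + (i + j + k + l)
      interchange = solve-∀

    shared : ∀ {f : Square → ℕ} {w} z P → w ∈ P → f w ≡ f z → distinct f M (z ∷ P) ≤ distinct f M P + 0
    shared {f} z P w∈P fw≡fz = ≤-trans (distinct-∷-shared f M z P w∈P fw≡fz) (m≤m+n _ 0)

  lines-∷-≤ : ∀ {w} z P → w ∈ P → SameLine w z → lines (z ∷ P) ≤ lines P + 3
  lines-∷-≤ z P w∈P (inj₁ same) =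
    lines-∷-≤-offsets z P 0 1 1 1 (shared z P w∈P same)
      (distinct-∷-≤ row M z P) (distinct-∷-≤ antidiagonal M z P) (distinct-∷-≤ diagonal M z P)
  lines-∷-≤ z P w∈P (inj₂ (inj₁ same)) =
    lines-∷-≤-offsets z P 1 0 1 1 (distinct-∷-≤ col M z P)
      (shared z P w∈P same) (distinct-∷-≤ antidiagonal M z P) (distinct-∷-≤ diagonal M z P)
  lines-∷-≤ {w} z P w∈P (inj₂ (inj₂ (inj₁ same))) =
    lines-∷-≤-offsets z P 1 1 1 0 (distinct-∷-≤ col M z P)
      (distinct-∷-≤ row M z P) (distinct-∷-≤ antidiagonal M z P) (shared z P w∈P (diagonal-≡ w z same))
  lines-∷-≤ z P w∈P (inj₂ (inj₂ (inj₂ same))) =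
    lines-∷-≤-offsets z P 1 1 0 1 (distinct-∷-≤ col M z P)
      (distinct-∷-≤ row M z P) (shared z P w∈P same) (distinct-∷-≤ diagonal M z P)

  lines-singleton-≤ : ∀ z → lines [ z ] ≤ 4
  lines-singleton-≤ z = +-mono-≤ (+-mono-≤ (+-mono-≤ (distinct-≤-length col M [ z ]) (distinct-≤-length row M [ z ]))
    (distinct-≤-length antidiagonal M [ z ])) (distinct-≤-length diagonal M [ z ])

  lines-mono : ∀ {P P′} → P ⊆ P′ → lines P ≤ lines P′
  lines-mono P⊆P′ = +-mono-≤ (+-mono-≤ (+-mono-≤ (distinct-mono col M P⊆P′) (distinct-mono row M P⊆P′))
    (distinct-mono antidiagonal M P⊆P′)) (distinct-mono diagonal M P⊆P′)

  module Spanning (Q : List Square) (connected : Connected Q) {p₀} (p₀∈Q : p₀ ∈ Q) where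

    absorb : ∀ {r} P R → p₀ ∈ P → r ∈ Q → r ∉ P → Q ⊆ P ∪ R →
      ∃₂ λ z (z∈R : z ∈ R) → lines (z ∷ P) ≤ lines P + 3
    absorb P R p₀∈P r∈Q r∉P Q⊆P∪R
      with w , z , w∈P , z∉P , w~z@(_ , z∈Q , _) ← Star-exit (_∈? P) (connected p₀ _ p₀∈Q r∈Q) p₀∈P r∉P
      with Q⊆P∪R z∈Q
    ... | inj₁ z∈P = ⊥-elim (z∉P z∈P)
    ... | inj₂ z∈R = z , z∈R , lines-∷-≤ z P w∈P (Adj⇒SameLine w~z)

    grow : ∀ n P R → length R ≤ n → p₀ ∈ P → R ⊆ Q → Q ⊆ P ∪ R → lines Q ≤ lines P + 3 * length R
    grow _ P [] _ _ _ Q⊆P∪[] = ≤-trans (lines-mono Q⊆P) (m≤m+n (lines P) 0)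
      where
      Q⊆P : Q ⊆ P
      Q⊆P q∈Q with Q⊆P∪[] q∈Q
      ... | inj₁ q∈P = q∈P
    grow (suc n) P (r ∷ R) (s≤s |R|≤n) p₀∈P R⊆Q Q⊆P∪R with r ∈? P
    ... | yes r∈P = ≤-trans (grow n P R |R|≤n p₀∈P (R⊆Q ∘ there) Q⊆P∪R′)
                            (+-monoʳ-≤ (lines P) (*-monoʳ-≤ 3 (n≤1+n (length R))))
      where
      Q⊆P∪R′ : Q ⊆ P ∪ R
      Q⊆P∪R′ q∈Q with Q⊆P∪R q∈Q
      ... | inj₁ q∈P         = inj₁ q∈P
      ... | inj₂ (here refl) = inj₁ r∈P
      ... | inj₂ (there q∈R) = inj₂ q∈R
    ... | no r∉P with z , z∈ , lines-step ← absorb P (r ∷ R) p₀∈P (R⊆Q (here refl)) r∉P Q⊆P∪R = begin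
      lines Q
        ≤⟨ grow n (z ∷ P) R′ |R′|≤n (there p₀∈P) (R⊆Q ∘ ─-⊆ (r ∷ R) z∈) Q⊆zP∪R′ ⟩
      lines (z ∷ P) + 3 * length R′   ≤⟨ +-monoˡ-≤ (3 * length R′) lines-step ⟩
      lines P + 3 + 3 * length R′     ≡⟨ cong (λ k → lines P + 3 + 3 * k) |R′|≡|R| ⟩
      lines P + 3 + 3 * length R      ≡⟨ +-assoc (lines P) 3 (3 * length R) ⟩
      lines P + (3 + 3 * length R)    ≡⟨ cong (lines P +_) (*-suc 3 (length R)) ⟨
      lines P + 3 * suc (length R)    ∎
      where
      open ≤-Reasoning
      R′ = (r ∷ R) ─ z∈
      |R′|≡|R| : length R′ ≡ length R
      |R′|≡|R| = suc-injective (sym (length-removeAt′ (r ∷ R) (index z∈)))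
      |R′|≤n : length R′ ≤ n
      |R′|≤n = subst (_≤ n) (sym |R′|≡|R|) |R|≤n
      Q⊆zP∪R′ : Q ⊆ (z ∷ P) ∪ R′
      Q⊆zP∪R′ q∈Q with Q⊆P∪R q∈Q
      ... | inj₁ q∈P = inj₁ (there q∈P)
      ... | inj₂ q∈rR with ∈-─ (r ∷ R) z∈ q∈rR
      ...   | inj₁ q≡z  = inj₁ (here q≡z)
      ...   | inj₂ q∈R′ = inj₂ q∈R′

  lines-≤-connected : ∀ q Q → Connected (q ∷ Q) → lines (q ∷ Q) ≤ 3 * length (q ∷ Q) + 1
  lines-≤-connected q Q connected = begin
    lines (q ∷ Q)                ≤⟨ grow (length Q) [ q ] Q ≤-refl (here refl) there split ⟩
    lines [ q ] + 3 * length Q   ≤⟨ +-monoˡ-≤ (3 * length Q) (lines-singleton-≤ q) ⟩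
    4 + 3 * length Q             ≡⟨ rearrange (length Q) ⟩
    3 * suc (length Q) + 1       ∎
    where
    open ≤-Reasoning
    open Spanning (q ∷ Q) connected (here refl)
    split : (q ∷ Q) ⊆ [ q ] ∪ Q
    split (here q≡) = inj₁ (here q≡)
    split (there p∈Q) = inj₂ p∈Q
    rearrange : ∀ n → 4 + 3 * n ≡ 3 * suc n + 1
    rearrange = solve-∀

  module Covering (Q : List Square) (dominating : Dominating N Q) where

    vacant : (Square → ℕ) → ℕ → ℕ
    vacant f v with occupied f Q v
    ... | zero  = 1
    ... | suc _ = 0

    occupied+vacant : ∀ f v → 1 ≤ occupied f Q v + vacant f v
    occupied+vacant f v with occupied f Q v
    ... | zero  = ≤-refl
    ... | suc _ = s≤s z≤n

    vacant-≤-1 : ∀ f v → vacant f v ≤ 1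
    vacant-≤-1 f v with occupied f Q v
    ... | zero  = ≤-refl
    ... | suc _ = z≤n

    N≤distinct+vacant : ∀ f → N ≤ distinct f M Q + ∑ (vacant f from 1) N
    N≤distinct+vacant f = begin
      N                                                         ≡⟨ trans (sym (*-identityʳ N)) (sym (∑-const 1 N)) ⟩
      ∑ (λ _ → 1) N                                             ≤⟨ ∑-mono-≤ N (λ i _ → occupied+vacant f (1 + i)) ⟩
      ∑ (λ i → occupied f Q (1 + i) + vacant f (1 + i)) N       ≡⟨ ∑-distrib-+ (occupied f Q from 1) (vacant f from 1) N ⟩
      ∑ (occupied f Q from 1) N + ∑ (vacant f from 1) N
        ≤⟨ +-monoˡ-≤ _ (∑-window-≤ (occupied f Q) 1 N (s≤s (m≤m+n N N))) ⟩
      distinct f M Q + ∑ (vacant f from 1) N                    ∎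
      where open ≤-Reasoning

    vacant-lines⇒occupied-diagonal : ∀ x y → OnBoard N (x , y) →
      occupied col Q x ≡ 0 → occupied row Q y ≡ 0 →
      1 ≤ occupied antidiagonal Q (x + y) + occupied diagonal Q (x + N ∸ y)
    vacant-lines⇒occupied-diagonal x y on-board col-free row-free with dominating (x , y) on-board
    ... | q , q∈Q , inj₁ refl                      = ⊥-elim (1+n≢0 (trans (sym (occupied-∈ col q∈Q)) col-free))
    ... | q , q∈Q , inj₂ (inj₁ same)               =
      ⊥-elim (1+n≢0 (trans (sym (occupied-∈ col q∈Q)) (trans (cong (occupied col Q) same) col-free)))
    ... | q , q∈Q , inj₂ (inj₂ (inj₁ same))        =
      ⊥-elim (1+n≢0 (trans (sym (occupied-∈ row q∈Q)) (trans (cong (occupied row Q) same) row-free)))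
    ... | q , q∈Q , inj₂ (inj₂ (inj₂ (inj₁ same))) = ≤-trans (≤-reflexive (sym on-diagonal)) (m≤n+m _ _)
      where
      on-diagonal : occupied diagonal Q (x + N ∸ y) ≡ 1
      on-diagonal = subst (λ v → occupied diagonal Q v ≡ 1) (diagonal-≡ q (x , y) same) (occupied-∈ diagonal q∈Q)
    ... | q , q∈Q , inj₂ (inj₂ (inj₂ (inj₂ same))) = ≤-trans (≤-reflexive (sym on-antidiagonal)) (m≤m+n _ _)
      where
      on-antidiagonal : occupied antidiagonal Q (x + y) ≡ 1
      on-antidiagonal = subst (λ v → occupied antidiagonal Q v ≡ 1) same (occupied-∈ antidiagonal q∈Q)

    vacant*vacant≤diagonals : ∀ x y → OnBoard N (x , y) →
      vacant col x * vacant row y ≤ occupied antidiagonal Q (x + y) + occupied diagonal Q (x + N ∸ y)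
    vacant*vacant≤diagonals x y on-board with occupied col Q x in col≡ | occupied row Q y in row≡
    ... | zero  | zero  = vacant-lines⇒occupied-diagonal x y on-board col≡ row≡
    ... | zero  | suc _ = z≤n
    ... | suc _ | _     = z≤n

    -- The rectangle [a, b] × [c, d] with vacant sides; row c is its bottom and row d its top.
    module Frame (a p c l : ℕ) (1≤a : 1 ≤ a) (b≤N : a + suc p ≤ N) (1≤c : 1 ≤ c) (d≤N : c + l ≤ N)
      (a-vacant : 0 < vacant col a) (b-vacant : 0 < vacant col (a + suc p))
      (c-vacant : 0 < vacant row c) (d-vacant : 0 < vacant row (c + l)) where

      b d e : ℕ
      b = a + suc p
      d = c + l
      e = N ∸ d

      occA occD : ℕ → ℕ
      occA = occupied antidiagonal Q
      occD = occupied diagonal Q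

      column-antidiagonals column-diagonals row-antidiagonals row-diagonals : ℕ → ℕ
      column-antidiagonals x = ∑ (λ i → occA (x + (c + i))) (suc l)
      column-diagonals     x = ∑ (λ i → occD (x + N ∸ (c + i))) (suc l)
      row-antidiagonals    y = ∑ (λ i → occA (suc a + i + y)) p
      row-diagonals        y = ∑ (λ i → occD (suc a + i + N ∸ y)) p

      on-column : ∀ x → 1 ≤ x → x ≤ N → ∀ i → i < suc l → OnBoard N (x , c + i)
      on-column x 1≤x x≤N i (s≤s i≤l) = (1≤x , x≤N) , (≤-trans 1≤c (m≤m+n c i) , ≤-trans (+-monoʳ-≤ c i≤l) d≤N)

      on-row : ∀ y → 1 ≤ y → y ≤ N → ∀ i → i < p → OnBoard N (suc a + i , y)
      on-row y 1≤y y≤N i i<p =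
        (s≤s z≤n , ≤-trans (≤-reflexive (sym (+-suc a i))) (≤-trans (+-monoʳ-≤ a (m<n⇒m<1+n i<p)) b≤N)) , (1≤y , y≤N)

      vacant-rows≤ : ∀ x → 1 ≤ x → x ≤ N → 0 < vacant col x →
        ∑ (vacant row from c) (suc l) ≤ column-antidiagonals x + column-diagonals x
      vacant-rows≤ x 1≤x x≤N x-vacant = ≤-trans
        (∑-mono-≤ (suc l) λ i i≤l → ≤-trans (m≤n*m _ _ {{>-nonZero x-vacant}})
          (vacant*vacant≤diagonals x (c + i) (on-column x 1≤x x≤N i i≤l)))
        (≤-reflexive (∑-distrib-+ _ _ (suc l)))

      vacant-columns≤ : ∀ y → 1 ≤ y → y ≤ N → 0 < vacant row y →
        ∑ (vacant col from suc a) p ≤ row-antidiagonals y + row-diagonals y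
      vacant-columns≤ y 1≤y y≤N y-vacant = ≤-trans
        (∑-mono-≤ p λ i i<p → ≤-trans (m≤m*n _ _ {{>-nonZero y-vacant}})
          (vacant*vacant≤diagonals (suc a + i) y (on-row y 1≤y y≤N i i<p)))
        (≤-reflexive (∑-distrib-+ _ _ p))

      N≡d+e : N ≡ d + e
      N≡d+e = sym (m+[n∸m]≡n d≤N)

      N∸c≡l+e : N ∸ c ≡ l + e
      N∸c≡l+e = trans (cong (_∸ c) (trans N≡d+e (+-assoc c l e))) (m+n∸m≡n c (l + e))

      N∸[c+i]≡[l∸i]+e : ∀ i → i ≤ l → N ∸ (c + i) ≡ (l ∸ i) + e
      N∸[c+i]≡[l∸i]+e i i≤l with t , i+t≡l ← m≤n⇒∃[o]m+o≡n i≤l = begin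
        N ∸ (c + i)                 ≡⟨ cong (_∸ (c + i)) N≡d+e ⟩
        c + l + e ∸ (c + i)         ≡⟨ cong (λ l → c + l + e ∸ (c + i)) (sym i+t≡l) ⟩
        c + (i + t) + e ∸ (c + i)   ≡⟨ cong (_∸ (c + i)) (reassoc c i t e) ⟩
        c + i + (t + e) ∸ (c + i)   ≡⟨ m+n∸m≡n (c + i) (t + e) ⟩
        t + e                       ≡⟨ cong (_+ e) (m+n∸m≡n i t) ⟨
        (i + t ∸ i) + e             ≡⟨ cong (λ l → l ∸ i + e) i+t≡l ⟩
        (l ∸ i) + e                 ∎
        where
        open ≡-Reasoning
        reassoc : ∀ c i t e → c + (i + t) + e ≡ c + i + (t + e)
        reassoc = solve-∀

      column-diagonals-reversed : ∀ x → column-diagonals x ≡ ∑ (occD from (x + e)) (suc l)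
      column-diagonals-reversed x = trans (∑-cong (suc l) λ i i<suc-l → cong occD (at i (≤-pred i<suc-l)))
                                          (∑-reverse (occD from (x + e)) (suc l))
        where
        at : ∀ i → i ≤ l → x + N ∸ (c + i) ≡ x + e + (l ∸ i)
        at i i≤l = begin
          x + N ∸ (c + i)       ≡⟨ +-∸-assoc x (≤-trans (+-monoʳ-≤ c i≤l) d≤N) ⟩
          x + (N ∸ (c + i))     ≡⟨ cong (x +_) (N∸[c+i]≡[l∸i]+e i i≤l) ⟩
          x + ((l ∸ i) + e)     ≡⟨ cong (x +_) (+-comm (l ∸ i) e) ⟩
          x + (e + (l ∸ i))     ≡⟨ +-assoc x e (l ∸ i) ⟨
          x + e + (l ∸ i)       ∎
          where open ≡-Reasoning

      b+d≤N+N : b + d ≤ N + N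
      b+d≤N+N = +-mono-≤ b≤N d≤N

      b+[l+e]≤N+N : b + (l + e) ≤ N + N
      b+[l+e]≤N+N = +-mono-≤ b≤N (≤-trans (m≤n+m (l + e) c) (≤-reflexive (trans (sym (+-assoc c l e)) (sym N≡d+e))))

      antidiagonals-left-top : column-antidiagonals a + row-antidiagonals d ≤ distinct antidiagonal M Q
      antidiagonals-left-top = begin
        column-antidiagonals a + row-antidiagonals d
          ≡⟨ cong₂ _+_ (∑-cong (suc l) λ i _ → cong occA (sym (+-assoc a c i)))
                       (∑-cong p λ i _ → cong occA (shift a c l i)) ⟩
        ∑ (occA from (a + c)) (suc l) + ∑ (occA from (a + c + suc l)) p
          ≤⟨ ∑-adjacent-windows-≤ occA (a + c) (suc l) p (≤-trans (≤-reflexive (end a c l p)) (m≤n⇒m≤1+n b+d≤N+N)) ⟩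
        distinct antidiagonal M Q ∎
        where
        open ≤-Reasoning
        shift : ∀ a c l i → suc a + i + (c + l) ≡ a + c + suc l + i
        shift = solve-∀
        end : ∀ a c l p → a + c + suc l + p ≡ a + suc p + (c + l)
        end = solve-∀

      antidiagonals-bottom-right : row-antidiagonals c + column-antidiagonals b ≤ distinct antidiagonal M Q
      antidiagonals-bottom-right = begin
        row-antidiagonals c + column-antidiagonals b
          ≡⟨ cong₂ _+_ (∑-cong p λ i _ → cong occA (shift₁ a c i))
                       (∑-cong (suc l) λ i _ → cong occA (shift₂ a c p i)) ⟩
        ∑ (occA from (suc a + c)) p + ∑ (occA from (suc a + c + p)) (suc l)
          ≤⟨ ∑-adjacent-windows-≤ occA (suc a + c) p (suc l) (≤-trans (≤-reflexive (end a c l p)) (s≤s b+d≤N+N)) ⟩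
        distinct antidiagonal M Q ∎
        where
        open ≤-Reasoning
        shift₁ : ∀ a c i → suc a + i + c ≡ suc a + c + i
        shift₁ = solve-∀
        shift₂ : ∀ a c p i → a + suc p + (c + i) ≡ suc a + c + p + i
        shift₂ = solve-∀
        end : ∀ a c l p → suc a + c + p + suc l ≡ suc (a + suc p + (c + l))
        end = solve-∀

      diagonals-left-bottom : column-diagonals a + row-diagonals c ≤ distinct diagonal M Q
      diagonals-left-bottom = begin
        column-diagonals a + row-diagonals c
          ≡⟨ cong₂ _+_ (column-diagonals-reversed a) (∑-cong p λ i _ → cong occD (at i)) ⟩
        ∑ (occD from (a + e)) (suc l) + ∑ (occD from (a + e + suc l)) p
          ≤⟨ ∑-adjacent-windows-≤ occD (a + e) (suc l) p
               (≤-trans (≤-reflexive (end a e l p)) (m≤n⇒m≤1+n b+[l+e]≤N+N)) ⟩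
        distinct diagonal M Q ∎
        where
        open ≤-Reasoning
        shift : ∀ a e l i → suc a + i + (l + e) ≡ a + e + suc l + i
        shift = solve-∀
        at : ∀ i → suc a + i + N ∸ c ≡ a + e + suc l + i
        at i = trans (+-∸-assoc (suc a + i) (≤-trans (m≤m+n c l) d≤N))
                     (trans (cong (suc a + i +_) N∸c≡l+e) (shift a e l i))
        end : ∀ a e l p → a + e + suc l + p ≡ a + suc p + (l + e)
        end = solve-∀

      diagonals-top-right : row-diagonals d + column-diagonals b ≤ distinct diagonal M Q
      diagonals-top-right = begin
        row-diagonals d + column-diagonals b
          ≡⟨ cong₂ _+_ (∑-cong p λ i _ → cong occD (at i))
                       (trans (column-diagonals-reversed b) (cong (λ s → ∑ (occD from s) (suc l)) (origin a p e))) ⟩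
        ∑ (occD from (suc a + e)) p + ∑ (occD from (suc a + e + p)) (suc l)
          ≤⟨ ∑-adjacent-windows-≤ occD (suc a + e) p (suc l) (≤-trans (≤-reflexive (end a e l p)) (s≤s b+[l+e]≤N+N)) ⟩
        distinct diagonal M Q ∎
        where
        open ≤-Reasoning
        shift : ∀ a e i → suc a + i + e ≡ suc a + e + i
        shift = solve-∀
        at : ∀ i → suc a + i + N ∸ d ≡ suc a + e + i
        at i = trans (+-∸-assoc (suc a + i) d≤N) (shift a e i)
        origin : ∀ a p e → a + suc p + e ≡ suc a + e + p
        origin = solve-∀
        end : ∀ a e l p → suc a + e + p + suc l ≡ suc (a + suc p + (l + e))
        end = solve-∀

      frame-bound : ∑ (vacant row from c) (suc l) + ∑ (vacant col from suc a) p ≤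
                    distinct antidiagonal M Q + distinct diagonal M Q
      frame-bound = *-cancelˡ-≤ 2 (begin
        2 * (F + E)                                    ≡⟨ double F E ⟩
        F + E + (F + E)                                ≤⟨ +-mono-≤ (+-mono-≤ left top) (+-mono-≤ right bottom) ⟩
        column-antidiagonals a + column-diagonals a + (row-antidiagonals d + row-diagonals d) +
          (column-antidiagonals b + column-diagonals b + (row-antidiagonals c + row-diagonals c))
                                                       ≡⟨ regroup (column-antidiagonals a) (column-diagonals a) (row-antidiagonals d)
                                                            (row-diagonals d) (column-antidiagonals b) (column-diagonals b)
                                                            (row-antidiagonals c) (row-diagonals c) ⟩
        column-antidiagonals a + row-antidiagonals d + (row-antidiagonals c + column-antidiagonals b) +
          (column-diagonals a + row-diagonals c + (row-diagonals d + column-diagonals b))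
                                                       ≤⟨ +-mono-≤ (+-mono-≤ antidiagonals-left-top antidiagonals-bottom-right)
                                                                   (+-mono-≤ diagonals-left-bottom diagonals-top-right) ⟩
        A + A + (D + D)                                ≡⟨ spread A D ⟨
        2 * (A + D)                                    ∎)
        where
        open ≤-Reasoning
        F E A D : ℕ
        F = ∑ (vacant row from c) (suc l)
        E = ∑ (vacant col from suc a) p
        A = distinct antidiagonal M Q
        D = distinct diagonal M Q
        c≤N : c ≤ N
        c≤N = ≤-trans (m≤m+n c l) d≤N
        1≤b : 1 ≤ b
        1≤b = ≤-trans 1≤a (m≤m+n a (suc p))
        1≤d : 1 ≤ d
        1≤d = ≤-trans 1≤c (m≤m+n c l)
        left   = vacant-rows≤ a 1≤a (≤-trans (m≤m+n a (suc p)) b≤N) a-vacant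
        right  = vacant-rows≤ b 1≤b b≤N b-vacant
        bottom = vacant-columns≤ c 1≤c c≤N c-vacant
        top    = vacant-columns≤ d 1≤d d≤N d-vacant
        double : ∀ x y → 2 * (x + y) ≡ x + y + (x + y)
        double = solve-∀
        spread : ∀ x y → 2 * (x + y) ≡ x + x + (y + y)
        spread = solve-∀
        regroup : ∀ la ld ta td ra rd ba bd → la + ld + (ta + td) + (ra + rd + (ba + bd)) ≡
                                              la + ta + (ba + ra) + (ld + bd + (td + rd))
        regroup = solve-∀

    few-vacant⇒N≤distinct+1 : ∀ f → ∑ (vacant f from 1) N ≤ 1 → N ≤ distinct f M Q + 1
    few-vacant⇒N≤distinct+1 f E≤1 = ≤-trans (N≤distinct+vacant f) (+-monoʳ-≤ _ E≤1)

    N+N≤lines+2⊎N≤distinct+1 : N + N ≤ lines Q + 2 ⊎ N ≤ distinct col M Q + 1 ⊎ N ≤ distinct row M Q + 1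
    N+N≤lines+2⊎N≤distinct+1 with ∑-support (vacant col from 1) N
    ... | inj₁ E≡0 = inj₂ (inj₁ (few-vacant⇒N≤distinct+1 col (≤-trans (≤-reflexive E≡0) z≤n)))
    ... | inj₂ (j , zero , _ , _ , _ , E≡) =
      inj₂ (inj₁ (few-vacant⇒N≤distinct+1 col (≤-trans (≤-reflexive E≡) (vacant-≤-1 col _))))
    ... | inj₂ (j , suc p , j+2+p≤N , a-vacant , b-vacant , E≡) with ∑-support (vacant row from 1) N
    ...   | inj₁ F≡0 = inj₂ (inj₂ (few-vacant⇒N≤distinct+1 row (≤-trans (≤-reflexive F≡0) z≤n)))
    ...   | inj₂ (j′ , l , j′+1+l≤N , c-vacant , d-vacant , F≡) = inj₁ (begin
      N + N                             ≤⟨ +-mono-≤ (N≤distinct+vacant col) (N≤distinct+vacant row) ⟩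
      X + E + (Y + F)                   ≤⟨ +-mono-≤ (+-monoʳ-≤ X E≤interior+2) (+-monoʳ-≤ Y (≤-reflexive F≡)) ⟩
      X + (I + 2) + (Y + F′)            ≡⟨ regroup X I Y F′ ⟩
      X + Y + (F′ + I) + 2              ≤⟨ +-monoˡ-≤ 2 (+-monoʳ-≤ (X + Y) frame-bound) ⟩
      X + Y + (A + D) + 2               ≡⟨ cong (_+ 2) (+-assoc (X + Y) A D) ⟨
      lines Q + 2                       ∎)
      where
      open ≤-Reasoning
      open Frame (suc j) p (suc j′) l (s≤s z≤n) (≤-trans (≤-reflexive (sym (+-suc j (suc p)))) j+2+p≤N)
                 (s≤s z≤n) (≤-trans (≤-reflexive (sym (+-suc j′ l))) j′+1+l≤N) a-vacant b-vacant c-vacant d-vacant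
      X Y A D E F F′ I : ℕ
      X = distinct col M Q
      Y = distinct row M Q
      A = distinct antidiagonal M Q
      D = distinct diagonal M Q
      E = ∑ (vacant col from 1) N
      F = ∑ (vacant row from 1) N
      F′ = ∑ (vacant row from suc j′) (suc l)
      I = ∑ (vacant col from suc (suc j)) p
      E≤interior+2 : E ≤ I + 2
      E≤interior+2 = begin
        E                                              ≡⟨ E≡ ⟩
        ∑ ((vacant col from 1) from j) (2 + p)         ≤⟨ ∑-≤-interior+2 _ p (λ i → vacant-≤-1 col _) ⟩
        ∑ (((vacant col from 1) from j) from 1) p + 2
          ≡⟨ cong (_+ 2) (∑-cong p λ i _ → cong (vacant col ∘ suc) (+-suc j i)) ⟩
        I + 2                                          ∎
      regroup : ∀ x i y f → x + (i + 2) + (y + f) ≡ x + y + (f + i) + 2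
      regroup = solve-∀

  N+N≤3*length+3 : ∀ q Q → Dominating N (q ∷ Q) → Connected (q ∷ Q) → N + N ≤ 3 * length (q ∷ Q) + 3
  N+N≤3*length+3 q Q dominating connected with Covering.N+N≤lines+2⊎N≤distinct+1 (q ∷ Q) dominating
  ... | inj₁ N+N≤L+2 = ≤-trans N+N≤L+2
    (≤-trans (+-monoˡ-≤ 2 (lines-≤-connected q Q connected)) (≤-reflexive (+-assoc (3 * length (q ∷ Q)) 1 2)))
  ... | inj₂ (inj₁ N≤X+1) = m≤n+1⇒m+m≤3n+3 {n = length (q ∷ Q)}
    (≤-trans N≤X+1 (+-monoˡ-≤ 1 (distinct-≤-length col M (q ∷ Q))))
  ... | inj₂ (inj₂ N≤Y+1) = m≤n+1⇒m+m≤3n+3 {n = length (q ∷ Q)}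
    (≤-trans N≤Y+1 (+-monoˡ-≤ 1 (distinct-≤-length row M (q ∷ Q))))

ceil2N/3-1-≤ : ∀ N k → N + N ≤ 3 * k + 3 → ceil2N/3-1 N ≤ k
ceil2N/3-1-≤ N k N+N≤ = ∸-monoˡ-≤ 1 (≤-pred (m<n*o⇒m/o<n {2 * N + 2} {suc (suc k)} {3} 2N+2<3[k+2]))
  where
  2N+2<3[k+2] : 2 * N + 2 < suc (suc k) * 3
  2N+2<3[k+2] = ≤-trans (≤-reflexive (lhs N)) (≤-trans (+-monoˡ-≤ 3 N+N≤) (≤-reflexive (rhs k)))
    where
    lhs : ∀ N → suc (2 * N + 2) ≡ N + N + 3
    lhs = solve-∀
    rhs : ∀ k → 3 * k + 3 + 3 ≡ suc (suc k) * 3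
    rhs = solve-∀

mainTheorem1 : (N : ℕ) → 1 ≤ N → (Q : List Square) →
    Unique Q → All (OnBoard N) Q →
    Dominating N Q → Connected Q →
    ceil2N/3-1 N ≤ length Q
mainTheorem1 N 1≤N [] _ _ dominating _ with dominating (1 , 1) ((≤-refl , 1≤N) , (≤-refl , 1≤N))
... | _ , () , _
mainTheorem1 N _ (q ∷ Q) _ _ dominating connected =
  ceil2N/3-1-≤ N (length (q ∷ Q)) (Board.N+N≤3*length+3 N q Q dominating connected)
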